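{- Let $k \geq 2$ and let $G$ be a graph on $n \geq 4k$ vertices with $\sigma_2(G) \geq 6k-2$ such that $G$ does not contain $k$ vertex-disjoint chorded cycles, but $G + e$ does for every $e \in E(\overline{G})$. Let $\mathcal C$ be a collection of $k-1$ vertex-disjoint chorded cycles of $G$ chosen so that (O1) the total number of vertices in the cycles of $\mathcal C$ is minimum; (O2) subject to (O1), the total number of chords is maximum; (O3) subject to (O1) and (O2), the number of vertices of a longest path in $R := G - \bigcup_{C \in \mathcal C} V(C)$ is maximum. Suppose $R$ has a spanning path. Let $Q = v_1 v_2 \cdots v_{|R|}$ be a spanning path of $R$, and let $v_iv_j \in E(G)$ be a hop on $Q$ with $i < j$. Then $v_{i+1}$ and $v_{i+2}$ are not both incident to hops on $Q$, and similarly $v_{j-1}$ and $v_{j-2}$ are not both incident to hops on $Q$.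
   Context: All graphs are finite and simple. $\sigma_2(G) := \min\{d_G(x)+d_G(y) : x \neq y,\ xy \notin E(G)\}$. A chorded cycle is a cycle together with at least one chord (an edge of $G$ joining two non-consecutive vertices of the cycle). If $Q = v_1 \cdots v_{|R|}$ is a spanning path of $R$, an edge $v_av_b$ of $G$ with $v_a, v_b \in V(R)$ is a hop (on $Q$) if $|a-b| > 1$. -}

module Defs where

open import Data.Nat using (ℕ; zero; suc; _+_; _∸_; _≤_; _<_; _≡ᵇ_; _<ᵇ_; ∣_-_∣)
open import Data.Bool using (Bool; true; false; _∧_; _∨_; not)
open import Data.Fin using (Fin; toℕ; _≟_)
open import Data.List using (List; []; _∷_; length; lookup; concat; map; filterᵇ; allFin; cartesianProduct)
open import Data.List.Relation.Unary.All using (All)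
open import Data.List.Relation.Unary.Unique.Propositional using (Unique)
open import Data.List.Membership.Propositional using (_∈_; _∉_)
open import Data.Product using (Σ; ∃; _×_; _,_; proj₁; proj₂)
open import Data.Sum using (_⊎_)
open import Relation.Binary.PropositionalEquality using (_≡_; _≢_)
open import Relation.Nullary using (¬_; ⌊_⌋)
open import Function using (_⇔_)
open import Data.Nat.ListAction using (sum)

-- A graph on vertex set Fin n is given by a Bool-valued adjacency function;
-- simplicity (symmetry, irreflexivity) is imposed as hypotheses in the theorem.
Adjacency : ℕ → Set
Adjacency n = Fin n → Fin n → Bool

Simple : {n : ℕ} → Adjacency n → Set
Simple {n} A = (∀ u v → A u v ≡ A v u) × (∀ v → A v v ≡ false)

Edge : {n : ℕ} → Adjacency n → Fin n → Fin n → Set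
Edge A u v = A u v ≡ true

deg : {n : ℕ} → Adjacency n → Fin n → ℕ
deg {n} A v = length (filterᵇ (A v) (allFin n))

-- sigma_2(G) ≥ s  (minimum over distinct non-adjacent pairs; vacuous if none)
σ₂≥ : {n : ℕ} → Adjacency n → ℕ → Set
σ₂≥ A s = ∀ x y → x ≢ y → A x y ≡ false → s ≤ deg A x + deg A y

addEdge : {n : ℕ} → Adjacency n → Fin n → Fin n → Adjacency n
addEdge A x y u v =
  A u v ∨ (⌊ u ≟ x ⌋ ∧ ⌊ v ≟ y ⌋) ∨ (⌊ u ≟ y ⌋ ∧ ⌊ v ≟ x ⌋)

Consec : (m : ℕ) → Fin m → Fin m → Set
Consec m a b = (toℕ b ≡ suc (toℕ a)) ⊎ ((toℕ a ≡ m ∸ 1) × (toℕ b ≡ 0))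

consecᵇ : (m : ℕ) → Fin m → Fin m → Bool
consecᵇ m a b = (toℕ b ≡ᵇ suc (toℕ a)) ∨ ((toℕ a ≡ᵇ m ∸ 1) ∧ (toℕ b ≡ᵇ 0))

IsCycle : {n : ℕ} → Adjacency n → List (Fin n) → Set
IsCycle A C =
  (3 ≤ length C) × Unique C ×
  (∀ a b → Consec (length C) a b → Edge A (lookup C a) (lookup C b))

IsChord : {n : ℕ} → Adjacency n → (C : List (Fin n)) → Fin (length C) → Fin (length C) → Set
IsChord A C a b =
  Edge A (lookup C a) (lookup C b) × (a ≢ b) ×
  ¬ Consec (length C) a b × ¬ Consec (length C) b a

IsChordedCycle : {n : ℕ} → Adjacency n → List (Fin n) → Set
IsChordedCycle A C = IsCycle A C × Σ (Fin (length C)) λ a → Σ (Fin (length C)) λ b → IsChord A C a b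

numChords : {n : ℕ} → Adjacency n → List (Fin n) → ℕ
numChords A C = length (filterᵇ chordᵇ (cartesianProduct (allFin (length C)) (allFin (length C))))
  where
  chordᵇ : Fin (length C) × Fin (length C) → Bool
  chordᵇ (a , b) = (toℕ a <ᵇ toℕ b) ∧ A (lookup C a) (lookup C b)
                   ∧ not (consecᵇ (length C) a b) ∧ not (consecᵇ (length C) b a)

DisjChorded : {n : ℕ} → Adjacency n → ℕ → List (List (Fin n)) → Set
DisjChorded A r 𝒞 = (length 𝒞 ≡ r) × All (IsChordedCycle A) 𝒞 × Unique (concat 𝒞)

HasDisjChorded : {n : ℕ} → Adjacency n → ℕ → Set
HasDisjChorded A r = ∃ λ 𝒞 → DisjChorded A r 𝒞

totalVertices : {n : ℕ} → List (List (Fin n)) → ℕ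
totalVertices 𝒞 = length (concat 𝒞)

totalChords : {n : ℕ} → Adjacency n → List (List (Fin n)) → ℕ
totalChords A 𝒞 = sum (map (numChords A) 𝒞)

IsPath : {n : ℕ} → Adjacency n → List (Fin n) → Set
IsPath A P = Unique P × (∀ a b → toℕ b ≡ suc (toℕ a) → Edge A (lookup P a) (lookup P b))

PathInR : {n : ℕ} → Adjacency n → List (List (Fin n)) → List (Fin n) → Set
PathInR A 𝒞 P = IsPath A P × All (λ v → v ∉ concat 𝒞) P

SpanningPathOfR : {n : ℕ} → Adjacency n → List (List (Fin n)) → List (Fin n) → Set
SpanningPathOfR A 𝒞 Q = IsPath A Q × (∀ v → (v ∈ Q) ⇔ (v ∉ concat 𝒞))

Optimal : {n : ℕ} → Adjacency n → ℕ → List (List (Fin n)) → Set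
Optimal A r 𝒞 =
  DisjChorded A r 𝒞 ×
  (∀ 𝒟 → DisjChorded A r 𝒟 → totalVertices 𝒞 ≤ totalVertices 𝒟) ×
  (∀ 𝒟 → DisjChorded A r 𝒟 → totalVertices 𝒟 ≡ totalVertices 𝒞 →
     totalChords A 𝒟 ≤ totalChords A 𝒞) ×
  (∀ 𝒟 → DisjChorded A r 𝒟 → totalVertices 𝒟 ≡ totalVertices 𝒞 →
     totalChords A 𝒟 ≡ totalChords A 𝒞 →
     ∀ P′ → PathInR A 𝒟 P′ → ∃ λ P → PathInR A 𝒞 P × length P′ ≤ length P)

Hop : {n : ℕ} → Adjacency n → (Q : List (Fin n)) → Fin (length Q) → Fin (length Q) → Set
Hop A Q a b = Edge A (lookup Q a) (lookup Q b) × (1 < ∣ toℕ a - toℕ b ∣)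

IncidentToHop : {n : ℕ} → Adjacency n → (Q : List (Fin n)) → Fin (length Q) → Set
IncidentToHop A Q a = Σ (Fin (length Q)) λ b → Hop A Q a b

-- Let v_i v_j (i + 2 ≤ j) be a hop on the spanning path Q of R, and suppose
-- v_{i+1} v_a and v_{i+2} v_b are hops as well.  A case analysis on where a
-- and b lie relative to i and j always exhibits, inside Q plus these three
-- hops, a cycle made of Q-edges and hops together with a chord of it.  All its
-- vertices lie on Q, hence in R, hence outside the k-1 cycles of 𝒞, so
-- together with 𝒞 it gives k disjoint chorded cycles — a contradiction.  The
-- statement about v_{j-1}, v_{j-2} is the same argument on the reversed path.
module Submission where

open import Defs
open import Data.Nat using (ℕ; zero; suc; _+_; _*_; _∸_; _≤_; _<_; z≤n; s≤s; pred; ∣_-_∣; _≤?_; _≟_)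
open import Data.Nat.Properties
open import Data.Fin using (Fin; toℕ; fromℕ<)
open import Data.Fin.Properties using (toℕ-fromℕ<; toℕ<n)
open import Data.Bool using (false)
open import Data.List using (List; []; _∷_; length; lookup; map; _++_; concat)
open import Data.List.Properties using (length-map)
open import Data.List.Relation.Unary.All as All using (All; []; _∷_)
import Data.List.Relation.Unary.All.Properties as AllP
open import Data.List.Relation.Unary.AllPairs using ([]; _∷_)
open import Data.List.Relation.Unary.Unique.Propositional using (Unique)
open import Data.List.Relation.Unary.Unique.Propositional.Properties using (++⁺)
open import Data.List.Relation.Binary.Disjoint.Propositional using (Disjoint)
open import Data.List.Membership.Propositional using (_∈_; _∉_)
open import Data.List.Relation.Unary.Any using (here; there)
open import Data.Product using (Σ; _×_; _,_; proj₁; proj₂)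
open import Data.Sum using (_⊎_; inj₁; inj₂)
open import Data.Empty using (⊥; ⊥-elim)
open import Relation.Binary.PropositionalEquality
  using (_≡_; _≢_; refl; sym; trans; cong; subst; subst₂)
open import Function.Bundles using (Equivalence)
open import Relation.Nullary using (¬_; yes; no)

data At {X : Set} : List X → ℕ → X → Set where
  here  : ∀ {x xs} → At (x ∷ xs) 0 x
  there : ∀ {x y xs t} → At xs t y → At (x ∷ xs) (suc t) y

at-lookup : ∀ {X : Set} (L : List X) (a : Fin (length L)) → At L (toℕ a) (lookup L a)
at-lookup (x ∷ L) Fin.zero    = here
at-lookup (x ∷ L) (Fin.suc a) = there (at-lookup L a)

at-functional : ∀ {X : Set} {L : List X} {t x y} → At L t x → At L t y → x ≡ y
at-functional here      here      = refl
at-functional (there p) (there q) = at-functional p q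

at-∈ : ∀ {X : Set} {L : List X} {t x} → At L t x → x ∈ L
at-∈ here      = here refl
at-∈ (there p) = there (at-∈ p)

at-injective : ∀ {X : Set} {L : List X} {p q v} → Unique L → At L p v → At L q v → p ≡ q
at-injective u       here      here      = refl
at-injective (d ∷ u) here      (there b) = ⊥-elim (All.lookup d (at-∈ b) refl)
at-injective (d ∷ u) (there a) here      = ⊥-elim (All.lookup d (at-∈ a) refl)
at-injective (d ∷ u) (there a) (there b) = cong suc (at-injective u a b)

at-< : ∀ {X : Set} {L : List X} {t x} → At L t x → t < length L
at-< here      = s≤s z≤n
at-< (there p) = s≤s (at-< p)

at-map⁻ : ∀ {X Y : Set} (f : X → Y) (L : List X) {t v} →
          At (map f L) t v → Σ X λ x → At L t x × v ≡ f x
at-map⁻ f (x ∷ L) here = x , here , refl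
at-map⁻ f (x ∷ L) (there p) with at-map⁻ f L p
... | y , q , e = y , there q , e

lookup-map-at : ∀ {X Y : Set} (f : X → Y) (L : List X) (a : Fin (length (map f L))) {x} →
                At L (toℕ a) x → lookup (map f L) a ≡ f x
lookup-map-at f L a ax with at-map⁻ f L (at-lookup (map f L) a)
... | z , az , e = trans e (cong f (at-functional az ax))

at-++ˡ : ∀ {X : Set} {L₁ : List X} L₂ {t x} → At L₁ t x → At (L₁ ++ L₂) t x
at-++ˡ L₂ here      = here
at-++ˡ L₂ (there p) = there (at-++ˡ L₂ p)

at-++ʳ : ∀ {X : Set} (L₁ : List X) {L₂ t x} → At L₂ t x → At (L₁ ++ L₂) (length L₁ + t) x
at-++ʳ []       p = p
at-++ʳ (y ∷ L₁) p = there (at-++ʳ L₁ p)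

lookupOr : ∀ {X : Set} → List X → X → ℕ → X
lookupOr []       d _       = d
lookupOr (x ∷ xs) d zero    = x
lookupOr (x ∷ xs) d (suc t) = lookupOr xs d t

lookupOr-lookup : ∀ {X : Set} (L : List X) d (a : Fin (length L)) →
                  lookup L a ≡ lookupOr L d (toℕ a)
lookupOr-lookup (x ∷ L) d Fin.zero    = refl
lookupOr-lookup (x ∷ L) d (Fin.suc a) = lookupOr-lookup L d a

lookupOr-at : ∀ {X : Set} (L : List X) d t → t < length L → At L t (lookupOr L d t)
lookupOr-at (x ∷ L) d zero    _        = here
lookupOr-at (x ∷ L) d (suc t) (s≤s lt) = there (lookupOr-at L d t lt)

up : ℕ → ℕ → List ℕ
up p zero    = p ∷ []
up p (suc k) = p ∷ up (suc p) k

down : ℕ → ℕ → List ℕ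
down lo zero    = lo ∷ []
down lo (suc k) = (suc k + lo) ∷ down lo k

length-up : ∀ p k → length (up p k) ≡ suc k
length-up p zero    = refl
length-up p (suc k) = cong suc (length-up (suc p) k)

at-up : ∀ p k o → o ≤ k → At (up p k) o (o + p)
at-up p zero    zero    _ = here
at-up p (suc k) zero    _ = here
at-up p (suc k) (suc o) (s≤s le) =
  there (subst (At (up (suc p) k) o) (+-suc o p) (at-up (suc p) k o le))

at-down-last : ∀ lo k → At (down lo k) k lo
at-down-last lo zero    = here
at-down-last lo (suc k) = there (at-down-last lo k)

Range : ℕ → ℕ → ℕ → Set
Range lo hi x = lo ≤ x × x ≤ hi

range-up : ∀ p k → All (Range p (k + p)) (up p k)
range-up p zero    = (≤-refl , ≤-refl) ∷ []
range-up p (suc k) = (≤-refl , m≤n+m p (suc k)) ∷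
  All.map (λ { {x} (l , h) → ≤-trans (n≤1+n p) l , subst (x ≤_) (+-suc k p) h })
          (range-up (suc p) k)

range-down : ∀ lo k → All (Range lo (k + lo)) (down lo k)
range-down lo zero    = (≤-refl , ≤-refl) ∷ []
range-down lo (suc k) = (m≤n+m lo (suc k) , ≤-refl) ∷
  All.map (λ { (l , h) → l , ≤-trans h (n≤1+n _) }) (range-down lo k)

widen : ∀ {lo hi lo′ hi′ L} → lo′ ≤ lo → hi ≤ hi′ → All (Range lo hi) L → All (Range lo′ hi′) L
widen a b = All.map (λ { (l , h) → ≤-trans a l , ≤-trans h b })

below-range : ∀ {x lo hi L} → x < lo → All (Range lo hi) L → All (x ≢_) L
below-range lt = All.map (λ { (l , _) eq → <⇒≢ (<-≤-trans lt l) eq })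

above-range : ∀ {x lo hi L} → hi < x → All (Range lo hi) L → All (x ≢_) L
above-range lt = All.map (λ { (_ , h) eq → <⇒≢ (≤-<-trans h lt) (sym eq) })

unique-up : ∀ p k → Unique (up p k)
unique-up p zero    = [] ∷ []
unique-up p (suc k) = below-range ≤-refl (range-up (suc p) k) ∷ unique-up (suc p) k

unique-down : ∀ lo k → Unique (down lo k)
unique-down lo zero    = [] ∷ []
unique-down lo (suc k) = above-range ≤-refl (range-down lo k) ∷ unique-down lo k

disjoint-ranges : ∀ {l₁ h₁ l₂ h₂ L₁ L₂} → All (Range l₁ h₁) L₁ → All (Range l₂ h₂) L₂ →
                  h₁ < l₂ ⊎ h₂ < l₁ → Disjoint L₁ L₂
disjoint-ranges r₁ r₂ sep (v₁ , v₂) with All.lookup r₁ v₁ | All.lookup r₂ v₂ | sep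
... | (_ , h) | (l , _) | inj₁ lt = <-irrefl refl (<-≤-trans (≤-<-trans h lt) l)
... | (l , _) | (_ , h) | inj₂ lt = <-irrefl refl (<-≤-trans (≤-<-trans h lt) l)

bounded : ∀ {lo hi m L} → hi < m → All (Range lo hi) L → All (_< m) L
bounded lt = All.map (λ { (_ , h) → ≤-<-trans h lt })

offset : ∀ {p q} → p ≤ q → Σ ℕ λ d → d + p ≡ q
offset {p} {q} le = q ∸ p , m∸n+n≡m le

offset< : ∀ {p q} → p < q → Σ ℕ λ d → suc d + p ≡ q
offset< {p} {q} lt = q ∸ suc p , trans (sym (+-suc (q ∸ suc p) p)) (m∸n+n≡m lt)

data Walk {X : Set} (R : X → X → Set) : X → List X → X → Set where
  one  : ∀ {u} → Walk R u (u ∷ []) u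
  step : ∀ {u v w L} → R u v → Walk R v L w → Walk R u (u ∷ L) w

module _ {X : Set} {R : X → X → Set} where

  walk-head : ∀ {u L w} → Walk R u L w → At L 0 u
  walk-head one        = here
  walk-head (step e W) = here

  walk-last : ∀ {u L w} → Walk R u L w → At L (pred (length L)) w
  walk-last one                  = here
  walk-last (step e one)         = there here
  walk-last (step e W@(step _ _)) = there (walk-last W)

  walk-edge : ∀ {u L w s x y} → Walk R u L w → At L s x → At L (suc s) y → R x y
  walk-edge (step e W) here      (there q) = subst (R _) (at-functional (walk-head W) q) e
  walk-edge (step e W) (there p) (there q) = walk-edge W p q

  walk-++ : ∀ {u L₁ v v′ L₂ w} → Walk R u L₁ v → R v v′ → Walk R v′ L₂ w → Walk R u (L₁ ++ L₂) w
  walk-++ one           e W₂ = step e W₂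
  walk-++ (step e₁ W₁) e W₂ = step e₁ (walk-++ W₁ e W₂)

Far : ℕ → ℕ → Set
Far u v = suc (suc u) ≤ v ⊎ suc (suc v) ≤ u

far-from-distance : ∀ u v → 1 < ∣ u - v ∣ → Far u v
far-from-distance u v h with ≤-total u v
... | inj₁ uv = inj₁ (≤-trans (+-monoˡ-≤ u (subst (2 ≤_) (m≤n⇒∣m-n∣≡n∸m uv) h))
                              (≤-reflexive (m∸n+n≡m uv)))
... | inj₂ vu = inj₂ (≤-trans (+-monoˡ-≤ v (subst (2 ≤_) (m≤n⇒∣n-m∣≡n∸m vu) h))
                              (≤-reflexive (m∸n+n≡m vu)))

reflect-gap : ∀ d u v M → d + u ≤ v → v ≤ M → d + (M ∸ v) ≤ M ∸ u
reflect-gap d u v M h vM = m+n≤o⇒m≤o∸n (d + (M ∸ v)) (begin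
  d + (M ∸ v) + u   ≡⟨ cong (_+ u) (+-comm d (M ∸ v)) ⟩
  M ∸ v + d + u     ≡⟨ +-assoc (M ∸ v) d u ⟩
  M ∸ v + (d + u)   ≤⟨ +-monoʳ-≤ (M ∸ v) h ⟩
  M ∸ v + v         ≡⟨ m∸n+n≡m vM ⟩
  M                 ∎)
  where open ≤-Reasoning

far-ordered : ∀ {u v} → Far u v → u < v → suc (suc u) ≤ v
far-ordered (inj₁ h) _   = h
far-ordered (inj₂ h) u<v = ⊥-elim (<-asym u<v (≤-trans (n≤1+n _) h))

far-reflect : ∀ M u v → u ≤ M → v ≤ M → Far u v → Far (M ∸ u) (M ∸ v)
far-reflect M u v uM vM (inj₁ h) = inj₂ (reflect-gap 2 u v M h vM)
far-reflect M u v uM vM (inj₂ h) = inj₁ (reflect-gap 2 v u M h uM)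

∸-step : ∀ M p → suc p ≤ M → M ∸ p ≡ suc (M ∸ suc p)
∸-step (suc M) zero    _        = refl
∸-step (suc M) (suc p) (s≤s le) = ∸-step M p le

reflect< : ∀ {m p} q → p < m → pred m ∸ q < m
reflect< {suc m} q _ = s≤s (m∸n≤m m q)

-- A path of G with m vertices, all satisfying P, read as a map from indices
-- to vertices (values past m are irrelevant).
record IndexedPath {n : ℕ} (A : Adjacency n) (P : Fin n → Set) (m : ℕ) : Set where
  field
    vertex    : ℕ → Fin n
    injective : ∀ p q → p < m → q < m → vertex p ≡ vertex q → p ≡ q
    adjacent  : ∀ p → suc p < m → Edge A (vertex p) (vertex (suc p))
    inside    : ∀ p → p < m → P (vertex p)

reversePath : ∀ {n} {A : Adjacency n} {P m} → (∀ u v → A u v ≡ A v u) →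
              IndexedPath A P m → IndexedPath A P m
reversePath {A = A} {m = m} symA π = record
  { vertex    = λ t → vertex (M ∸ t)
  ; injective = λ p q pm qm e → ∸-cancelˡ-≡ (<⇒≤pred pm) (<⇒≤pred qm)
                  (injective _ _ (reflect< p pm) (reflect< q pm) e)
  ; adjacent  = adjacent′
  ; inside    = λ p pm → inside (M ∸ p) (reflect< p pm)
  }
  where
  open IndexedPath π
  M : ℕ
  M = pred m
  adjacent′ : ∀ p → suc p < m → Edge A (vertex (M ∸ p)) (vertex (M ∸ suc p))
  adjacent′ p lt rewrite ∸-step M p (<⇒≤pred lt) =
    trans (symA _ _) (adjacent (M ∸ suc p) (subst (_< m) (∸-step M p (<⇒≤pred lt)) (reflect< p lt)))

ChordedCycleIn : ∀ {n} → Adjacency n → (Fin n → Set) → Set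
ChordedCycleIn {n} A P = Σ (List (Fin n)) λ C → IsChordedCycle A C × All P C

module PathCycles {n : ℕ} {A : Adjacency n} (symA : ∀ u v → A u v ≡ A v u)
                  {P : Fin n → Set} {m : ℕ} (π : IndexedPath A P m) where
  open IndexedPath π

  E : ℕ → ℕ → Set
  E p q = Edge A (vertex p) (vertex q)

  E-sym : ∀ {p q} → E p q → E q p
  E-sym {p} {q} e = trans (symA (vertex q) (vertex p)) e

  unique-vertices : ∀ {L} → Unique L → All (_< m) L → Unique (map vertex L)
  unique-vertices []       []        = []
  unique-vertices {x ∷ L} (d ∷ u) (b ∷ bs) = distinct d bs ∷ unique-vertices u bs
    where
    distinct : ∀ {L′} → All (x ≢_) L′ → All (_< m) L′ → All (vertex x ≢_) (map vertex L′)
    distinct []       []         = []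
    distinct (d₁ ∷ ds) (b₁ ∷ bs₁) = (λ eq → d₁ (injective _ _ b b₁ eq)) ∷ distinct ds bs₁

  inside-all : ∀ {L} → All (_< m) L → All P (map vertex L)
  inside-all []       = []
  inside-all (b ∷ bs) = inside _ b ∷ inside-all bs

  cycleOfWalk : ∀ {L u w} → Walk E u L w → E w u → Unique L → All (_< m) L →
                3 ≤ length L → IsCycle A (map vertex L)
  cycleOfWalk {L} W closing uq bnd len3 =
    subst (3 ≤_) (sym (length-map vertex L)) len3 , unique-vertices uq bnd , edges
    where
    edges : ∀ a b → Consec (length (map vertex L)) a b →
            Edge A (lookup (map vertex L) a) (lookup (map vertex L) b)
    edges a b c with at-map⁻ vertex L (at-lookup _ a) | at-map⁻ vertex L (at-lookup _ b)
    ... | x , ax , ea | y , ay , eb = subst₂ (Edge A) (sym ea) (sym eb) (consecutive c)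
      where
      consecutive : Consec (length (map vertex L)) a b → E x y
      consecutive (inj₁ next) = walk-edge W ax (subst (λ r → At L r y) next ay)
      consecutive (inj₂ (a-last , b-first)) =
        subst₂ E (at-functional (walk-last W) (subst (λ r → At L r x) a≡last ax))
                 (at-functional (walk-head W) (subst (λ r → At L r y) b-first ay)) closing
        where
        a≡last : toℕ a ≡ pred (length L)
        a≡last = trans a-last (trans (cong (_∸ 1) (length-map vertex L))
                                     (sym (pred[m∸n]≡m∸[1+n] (length L) 0)))

  chordedCycleOfWalk : ∀ {L u w s t x y} → Walk E u L w → E w u → Unique L → All (_< m) L →
                       At L s x → At L t y → s < t → t ≢ suc s →
                       ¬ (s ≡ 0 × t ≡ pred (length L)) → E x y → ChordedCycleIn A P
  chordedCycleOfWalk {L} {s = s} {t} {x} {y} W closing uq bnd ax ay s<t t≢1+s notWrap exy =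
    map vertex L , (cycleOfWalk W closing uq bnd len3 , a , b , chord) , inside-all bnd
    where
    len≡ : length (map vertex L) ≡ length L
    len≡ = length-map vertex L
    len3 : 3 ≤ length L
    len3 = ≤-trans (s≤s (≤-trans (s≤s (s≤s z≤n)) (≤∧≢⇒< s<t (λ e → t≢1+s (sym e))))) (at-< ay)
    a b : Fin (length (map vertex L))
    a = fromℕ< (subst (s <_) (sym len≡) (at-< ax))
    b = fromℕ< (subst (t <_) (sym len≡) (at-< ay))
    ta : toℕ a ≡ s
    ta = toℕ-fromℕ< _
    tb : toℕ b ≡ t
    tb = toℕ-fromℕ< _
    chord : IsChord A (map vertex L) a b
    chord = edge , a≢b , not-ab , not-ba
      where
      edge : Edge A (lookup (map vertex L) a) (lookup (map vertex L) b)
      edge = subst₂ (Edge A)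
        (sym (lookup-map-at vertex L a (subst (λ r → At L r x) (sym ta) ax)))
        (sym (lookup-map-at vertex L b (subst (λ r → At L r y) (sym tb) ay))) exy
      a≢b : a ≢ b
      a≢b eq = <⇒≢ s<t (trans (sym ta) (trans (cong toℕ eq) tb))
      not-ab : ¬ Consec (length (map vertex L)) a b
      not-ab (inj₁ eq)       = t≢1+s (trans (sym tb) (trans eq (cong suc ta)))
      not-ab (inj₂ (_ , b0)) = <⇒≢ (≤-trans (s≤s z≤n) s<t) (sym (trans (sym tb) b0))
      not-ba : ¬ Consec (length (map vertex L)) b a
      not-ba (inj₁ eq)        = <⇒≢ (≤-trans s<t (n≤1+n t)) (trans (sym ta) (trans eq (cong suc tb)))
      not-ba (inj₂ (bl , a0)) = notWrap (trans (sym ta) a0 ,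
        trans (sym tb) (trans bl (trans (cong (_∸ 1) len≡) (sym (pred[m∸n]≡m∸[1+n] (length L) 0)))))

  walk-up : ∀ p k → k + p < m → Walk E p (up p k) (k + p)
  walk-up p zero    _ = one
  walk-up p (suc k) b =
    step (adjacent p (≤-<-trans (s≤s (m≤n+m p k)) b))
         (subst (Walk E (suc p) (up (suc p) k)) (+-suc k p)
                (walk-up (suc p) k (subst (_< m) (sym (+-suc k p)) b)))

  walk-down : ∀ lo k → k + lo < m → Walk E (k + lo) (down lo k) lo
  walk-down lo zero    _ = one
  walk-down lo (suc k) b = step (E-sym (adjacent (k + lo) b)) (walk-down lo k (≤-trans (n≤1+n _) b))

  -- Shape 1: edges p–(q+1) and q–r with p < q and q+2 ≤ r < m.  The cycle is
  -- p … q r (r-1) … (q+1) p, with the path edge q(q+1) as chord.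
  hookCycle : ∀ {p q r} → p < q → suc (suc q) ≤ r → r < m → E p (suc q) → E q r →
              ChordedCycleIn A P
  hookCycle {p} p<q q+2≤r r<m ep eq with offset< p<q | offset< q+2≤r
  ... | d₁ , refl | d₂ , refl =
    chordedCycleOfWalk (walk-++ (walk-up p (suc d₁) q<m) eq (walk-down (suc q) (suc d₂) r<m))
      (E-sym ep) unique bound at-q at-q+1 s<t t≢1+s (λ { (() , _) })
      (adjacent q (≤-trans (s≤s (m≤n+m (suc q) (suc d₂))) r<m))
    where
    q : ℕ
    q = suc d₁ + p
    L₁ L₂ : List ℕ
    L₁ = up p (suc d₁)
    L₂ = down (suc q) (suc d₂)
    q<m : q < m
    q<m = ≤-trans (m≤n+m (suc q) (suc d₂)) (<⇒≤ r<m)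
    unique : Unique (L₁ ++ L₂)
    unique = ++⁺ (unique-up p (suc d₁)) (unique-down (suc q) (suc d₂))
                 (disjoint-ranges (range-up p (suc d₁)) (range-down (suc q) (suc d₂)) (inj₁ ≤-refl))
    bound : All (_< m) (L₁ ++ L₂)
    bound = AllP.++⁺ (bounded q<m (range-up p (suc d₁))) (bounded r<m (range-down (suc q) (suc d₂)))
    at-q : At (L₁ ++ L₂) (suc d₁) q
    at-q = at-++ˡ L₂ (at-up p (suc d₁) (suc d₁) ≤-refl)
    at-q+1 : At (L₁ ++ L₂) (length L₁ + suc d₂) (suc q)
    at-q+1 = at-++ʳ L₁ (at-down-last (suc q) (suc d₂))
    len₁ : length L₁ ≡ suc (suc d₁)
    len₁ = length-up p (suc d₁)
    s<t : suc d₁ < length L₁ + suc d₂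
    s<t = subst (λ z → suc d₁ < z + suc d₂) (sym len₁) (m≤m+n (suc (suc d₁)) (suc d₂))
    t≢1+s : length L₁ + suc d₂ ≢ suc (suc d₁)
    t≢1+s e with +-cancelˡ-≡ (suc (suc d₁)) (suc d₂) 0
                   (trans (subst (λ z → z + suc d₂ ≡ suc (suc d₁)) len₁ e) (sym (+-identityʳ _)))
    ... | ()

  -- Shape 2: edges p–r and s–t with p ≤ s, s+2 ≤ t ≤ r < m, not both equal
  -- to p–r.  The cycle is p … r p, with s–t as chord.
  spanCycle : ∀ {p s t r} → p ≤ s → suc (suc s) ≤ t → t ≤ r → r < m →
              ¬ (s ≡ p × t ≡ r) → E p r → E s t → ChordedCycleIn A P
  spanCycle {p} p≤s s+2≤t t≤r r<m notBoth epr est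
    with offset (≤-trans p≤s (≤-trans (<⇒≤ (<-trans (n<1+n _) s+2≤t)) t≤r))
       | offset p≤s | offset (≤-trans p≤s (<⇒≤ (<-trans (n<1+n _) s+2≤t)))
  ... | k , refl | os , refl | ot , refl =
    chordedCycleOfWalk (walk-up p k r<m) (E-sym epr) (unique-up p k) (bounded r<m (range-up p k))
      (at-up p k os os≤k) (at-up p k ot ot≤k) os<ot ot≢1+os notWrap est
    where
    ot≤k : ot ≤ k
    ot≤k = +-cancelʳ-≤ p ot k t≤r
    os≤k : os ≤ k
    os≤k = ≤-trans (+-cancelʳ-≤ p os ot (≤-trans (n≤1+n _) (≤-trans (n≤1+n _) s+2≤t))) ot≤k
    os<ot : os < ot
    os<ot = +-cancelʳ-< p os ot (≤-trans (n≤1+n _) s+2≤t)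
    ot≢1+os : ot ≢ suc os
    ot≢1+os refl = 1+n≰n s+2≤t
    notWrap : ¬ (os ≡ 0 × ot ≡ pred (length (up p k)))
    notWrap (os≡0 , ot≡last) =
      notBoth (cong (_+ p) os≡0 , cong (_+ p) (trans ot≡last (cong pred (length-up p k))))

  -- Shape 3: edges i–j, (i+1)–a, (i+2)–b with i+3 ≤ j < a < b < m.  The cycle
  -- is a … b (i+2) … j i (i+1) a, with the path edge (i+1)(i+2) as chord.
  crossCycle : ∀ {i j a b} → suc (suc (suc i)) ≤ j → j < a → a < b → b < m →
               E i j → E (suc i) a → E (suc (suc i)) b → ChordedCycleIn A P
  crossCycle {i} {j} {a} i+3≤j j<a a<b b<m e₁ e₂ e₃
    with offset (≤-trans (n≤1+n _) i+3≤j) | offset (<⇒≤ a<b)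
  ... | ky , refl | ka , refl =
    chordedCycleOfWalk (walk-++ (walk-up a ka b<m) (E-sym e₃)
                          (walk-++ (walk-up y ky j<m) (E-sym e₁) (walk-up i 1 i+1<m)))
      e₂ unique bound at-y at-i+1 s<t t≢1+s notWrap (E-sym (adjacent (suc i) i+2<m))
    where
    y : ℕ
    y = suc (suc i)
    L₁ L₂ L₃ L : List ℕ
    L₁ = up a ka
    L₂ = up y ky
    L₃ = up i 1
    L = L₁ ++ (L₂ ++ L₃)
    j<m : ky + y < m
    j<m = <-trans j<a (<-trans a<b b<m)
    i+2<m : y < m
    i+2<m = ≤-trans i+3≤j (<⇒≤ j<m)
    i+1<m : suc i < m
    i+1<m = ≤-trans (n≤1+n _) i+2<m
    range₂₃ : All (Range i (ky + y)) (L₂ ++ L₃)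
    range₂₃ = AllP.++⁺ (widen (≤-trans (n≤1+n _) (n≤1+n _)) ≤-refl (range-up y ky))
                       (widen ≤-refl (≤-trans (n≤1+n _) (≤-trans (n≤1+n _) i+3≤j)) (range-up i 1))
    unique : Unique L
    unique = ++⁺ (unique-up a ka)
                 (++⁺ (unique-up y ky) (unique-up i 1)
                      (disjoint-ranges (range-up y ky) (range-up i 1) (inj₂ ≤-refl)))
                 (disjoint-ranges (range-up a ka) range₂₃ (inj₂ j<a))
    bound : All (_< m) L
    bound = AllP.++⁺ (bounded b<m (range-up a ka)) (bounded j<m range₂₃)
    at-y : At L (length L₁ + 0) y
    at-y = at-++ʳ L₁ (at-++ˡ L₃ (at-up y ky 0 z≤n))
    at-i+1 : At L (length L₁ + (length L₂ + 1)) (suc i)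
    at-i+1 = at-++ʳ L₁ (at-++ʳ L₂ (at-up i 1 1 ≤-refl))
    s<t : length L₁ + 0 < length L₁ + (length L₂ + 1)
    s<t = +-monoʳ-< (length L₁) (m≤n+m 1 (length L₂))
    t≢1+s : length L₁ + (length L₂ + 1) ≢ suc (length L₁ + 0)
    t≢1+s e with trans (sym (length-up y ky))
                  (+-cancelʳ-≡ 1 (length L₂) 0 (+-cancelˡ-≡ (length L₁) (length L₂ + 1) 1
                     (trans e (trans (cong suc (+-identityʳ _)) (sym (+-comm (length L₁) 1))))))
    ... | ()
    notWrap : ¬ (length L₁ + 0 ≡ 0 × length L₁ + (length L₂ + 1) ≡ pred (length L))
    notWrap (e , _) with trans (sym (length-up a ka)) (trans (sym (+-identityʳ _)) e)
    ... | ()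

  HopFrom : ℕ → Set
  HopFrom u = Σ ℕ λ b → b < m × Far u b × E u b

  consecutiveHops : ∀ {i j} → suc (suc i) ≤ j → j < m → E i j →
                    HopFrom (suc i) → HopFrom (suc (suc i)) → ChordedCycleIn A P
  consecutiveHops i+2≤j j<m e₁ (a , _ , inj₂ a+2≤i+1 , e₂) _ =
    hookCycle (≤-pred a+2≤i+1) i+2≤j j<m (E-sym e₂) e₁
  consecutiveHops {i} {j} i+2≤j j<m e₁ (a , a<m , inj₁ i+3≤a , e₂) (b , b<m , far-b , e₃)
    with a ≤? j
  ... | yes a≤j = spanCycle (n≤1+n i) i+3≤a a≤j j<m (λ { (() , _) }) e₁ e₂
  ... | no a≰j with j ≟ suc (suc i)
  ...   | yes refl = hookCycle ≤-refl i+3≤a a<m e₁ e₂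
  ...   | no j≢i+2 with far-b
  ...     | inj₂ b+2≤i+2 = hookCycle (≤-pred b+2≤i+2) i+3≤a a<m (E-sym e₃) e₂
  ...     | inj₁ i+4≤b with b ≤? j
  ...       | yes b≤j = spanCycle (≤-trans (n≤1+n i) (n≤1+n _)) i+4≤b b≤j j<m (λ { (() , _) }) e₁ e₃
  ...       | no b≰j with b ≤? a
  ...         | yes b≤a = spanCycle (n≤1+n _) i+4≤b b≤a a<m (λ { (() , _) }) e₂ e₃
  ...         | no b≰a  = crossCycle (≤∧≢⇒< i+2≤j (λ e → j≢i+2 (sym e))) (≰⇒> a≰j) (≰⇒> b≰a) b<m e₁ e₂ e₃

-- The mirror image of consecutiveHops, obtained on the reversed path: a hop
-- i–j followed by hops at both j-1 and j-2 also yields a chorded cycle.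
module Mirror {n : ℕ} {A : Adjacency n} (symA : ∀ u v → A u v ≡ A v u)
              {P : Fin n → Set} {m : ℕ} (π : IndexedPath A P m) where
  open PathCycles symA π
  private
    module Rev = PathCycles symA (reversePath symA π)
    M : ℕ
    M = pred m

  mirror-edge : ∀ {u v} → u ≤ M → v ≤ M → E u v → Rev.E (M ∸ u) (M ∸ v)
  mirror-edge uM vM e = subst₂ E (sym (m∸[m∸n]≡n uM)) (sym (m∸[m∸n]≡n vM)) e

  mirror-hop : ∀ {u} → u < m → HopFrom u → Rev.HopFrom (M ∸ u)
  mirror-hop {u} u<m (b , b<m , far , e) =
    M ∸ b , reflect< b u<m , far-reflect M u b (<⇒≤pred u<m) (<⇒≤pred b<m) far ,
    mirror-edge (<⇒≤pred u<m) (<⇒≤pred b<m) e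

  hopsBeforeHop : ∀ {i j p q} → suc (suc i) ≤ j → j < m → E i j →
                  suc p ≡ j → suc (suc q) ≡ j → HopFrom p → HopFrom q → ChordedCycleIn A P
  hopsBeforeHop {i} {j} {p} {q} i+2≤j j<m e p+1≡j q+2≡j hp hq =
    Rev.consecutiveHops (reflect-gap 2 i j M i+2≤j jM) (reflect< i j<m)
      (mirror-edge jM (≤-trans (≤-trans (n≤1+n _) (n≤1+n _)) (≤-trans i+2≤j jM)) (E-sym e))
      (subst Rev.HopFrom p↦ (mirror-hop (≤-trans (≤-reflexive p+1≡j) (<⇒≤ j<m)) hp))
      (subst Rev.HopFrom q↦ (mirror-hop (≤-trans (n≤1+n _) (≤-trans (≤-reflexive q+2≡j) (<⇒≤ j<m))) hq))
    where
    jM : j ≤ M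
    jM = <⇒≤pred j<m
    p↦ : M ∸ p ≡ suc (M ∸ j)
    p↦ = trans (∸-step M p (subst (_≤ M) (sym p+1≡j) jM)) (cong (λ z → suc (M ∸ z)) p+1≡j)
    q↦ : M ∸ q ≡ suc (suc (M ∸ j))
    q↦ = trans (∸-step M q (≤-trans (n≤1+n _) (subst (_≤ M) (sym q+2≡j) jM)))
           (cong suc (trans (∸-step M (suc q) (subst (_≤ M) (sym q+2≡j) jM))
                            (cong (λ z → suc (M ∸ z)) q+2≡j)))

pathIndexing : ∀ {n} {A : Adjacency n} {P : Fin n → Set} (Q : List (Fin n)) → Fin n →
               IsPath A Q → All P Q → IndexedPath A P (length Q)
pathIndexing {A = A} Q d (unique , adjacentQ) allP = record
  { vertex    = lookupOr Q d
  ; injective = λ p q pm qm e →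
      at-injective unique (lookupOr-at Q d p pm) (subst (At Q q) (sym e) (lookupOr-at Q d q qm))
  ; adjacent  = adjacent
  ; inside    = λ p pm → All.lookup allP (at-∈ (lookupOr-at Q d p pm))
  }
  where
  vertex-at : ∀ p (pm : p < length Q) → lookup Q (fromℕ< pm) ≡ lookupOr Q d p
  vertex-at p pm = trans (lookupOr-lookup Q d _) (cong (lookupOr Q d) (toℕ-fromℕ< pm))
  adjacent : ∀ p → suc p < length Q → Edge A (lookupOr Q d p) (lookupOr Q d (suc p))
  adjacent p lt = subst₂ (Edge A) (vertex-at p p<) (vertex-at (suc p) lt)
    (adjacentQ (fromℕ< p<) (fromℕ< lt) (trans (toℕ-fromℕ< lt) (cong suc (sym (toℕ-fromℕ< p<)))))
    where
    p< : p < length Q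
    p< = ≤-trans (n≤1+n _) lt

module PathHops {n : ℕ} {A : Adjacency n} (symA : ∀ u v → A u v ≡ A v u) {P : Fin n → Set}
                (Q : List (Fin n)) (d : Fin n) (isPath : IsPath A Q) (allP : All P Q) where
  open PathCycles symA (pathIndexing Q d isPath allP)

  hop-edge : ∀ {a b} → Hop A Q a b → E (toℕ a) (toℕ b)
  hop-edge {a} {b} (e , _) = subst₂ (Edge A) (lookupOr-lookup Q d a) (lookupOr-lookup Q d b) e

  incident-hop : ∀ {a} → IncidentToHop A Q a → HopFrom (toℕ a)
  incident-hop {a} (b , hop@(_ , dist)) =
    toℕ b , toℕ<n b , far-from-distance (toℕ a) (toℕ b) dist , hop-edge hop

extendCollection : ∀ {n} {A : Adjacency n} {r 𝒞} → DisjChorded A r 𝒞 →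
                   ChordedCycleIn A (_∉ concat 𝒞) → HasDisjChorded A (suc r)
extendCollection {𝒞 = 𝒞} (len , chorded , disjoint) (C , isChorded , avoids) =
  C ∷ 𝒞 , cong suc len , isChorded ∷ chorded ,
  ++⁺ (proj₁ (proj₂ (proj₁ isChorded))) disjoint (λ (v₁ , v₂) → All.lookup avoids v₁ v₂)

-- Lemma 30.
lemma30 : (k n : ℕ) → 2 ≤ k → 4 * k ≤ n →
    (A : Adjacency n) → Simple A →
    σ₂≥ A (6 * k ∸ 2) →
    ¬ HasDisjChorded A k →
    (∀ x y → x ≢ y → A x y ≡ false → HasDisjChorded (addEdge A x y) k) →
    (𝒞 : List (List (Fin n))) → Optimal A (k ∸ 1) 𝒞 →
    (Q : List (Fin n)) → SpanningPathOfR A 𝒞 Q →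
    (i j : Fin (length Q)) → Hop A Q i j → toℕ i < toℕ j →
    (∀ p q → toℕ p ≡ suc (toℕ i) → toℕ q ≡ suc (suc (toℕ i)) →
       ¬ (IncidentToHop A Q p × IncidentToHop A Q q)) ×
    (∀ p q → suc (toℕ p) ≡ toℕ j → suc (suc (toℕ q)) ≡ toℕ j →
       ¬ (IncidentToHop A Q p × IncidentToHop A Q q))
lemma30 zero _ () _ _ _ _ _ _ _ _ _ _ _ _ _ _
lemma30 (suc k) n _ _ A (symA , _) _ noK _ 𝒞 optimal Q (isPath , spans) i j hop i<j =
  after , before
  where
  inR : All (_∉ concat 𝒞) Q
  inR = All.tabulate (λ {v} v∈Q → Equivalence.to (spans v) v∈Q)
  π : IndexedPath A (_∉ concat 𝒞) (length Q)
  π = pathIndexing Q (lookup Q i) isPath inR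
  open PathCycles symA π
  open Mirror symA π
  open PathHops symA Q (lookup Q i) isPath inR
  impossible : ChordedCycleIn A (_∉ concat 𝒞) → ⊥
  impossible C = noK (extendCollection {A = A} (proj₁ optimal) C)
  i+2≤j : suc (suc (toℕ i)) ≤ toℕ j
  i+2≤j = far-ordered (far-from-distance (toℕ i) (toℕ j) (proj₂ hop)) i<j
  after : ∀ p q → toℕ p ≡ suc (toℕ i) → toℕ q ≡ suc (suc (toℕ i)) →
          ¬ (IncidentToHop A Q p × IncidentToHop A Q q)
  after p q p≡ q≡ (hp , hq) = impossible (consecutiveHops i+2≤j (toℕ<n j) (hop-edge hop)
    (subst HopFrom p≡ (incident-hop hp)) (subst HopFrom q≡ (incident-hop hq)))
  before : ∀ p q → suc (toℕ p) ≡ toℕ j → suc (suc (toℕ q)) ≡ toℕ j →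
           ¬ (IncidentToHop A Q p × IncidentToHop A Q q)
  before p q p≡ q≡ (hp , hq) = impossible (hopsBeforeHop i+2≤j (toℕ<n j) (hop-edge hop)
    p≡ q≡ (incident-hop hp) (incident-hop hq))
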